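{- Let $G$ be a locally linear graph and let $G^*$ be its triangle graph. Then $G^*$ does not contain an induced subgraph isomorphic to $K_4-e$ (the complete graph on four vertices with one edge deleted).
   Context: All graphs are finite, simple and undirected. A graph $G$ is locally linear if it has no isolated vertices and for every vertex $v$ the subgraph induced on its neighbourhood $N(v)=\{w\in V(G): w\sim v, w\neq v\}$ is $1$-regular; equivalently, every edge of $G$ lies in exactly one triangle (so two distinct triangles of $G$ share at most one vertex). The triangle graph $G^*$ of a locally linear graph $G$ is the graph whose vertex set is the set of triangles of $G$, two distinct triangles being adjacent in $G^*$ if and only if they share a common vertex in $G$. -}

module Defs where

open import Data.Nat using (ℕ)
open import Data.Fin using (Fin; zero; suc; _<_)
open import Data.Product using (Σ; ∃; _×_; _,_)
open import Data.Sum using (_⊎_)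
open import Data.Empty using (⊥)
open import Data.Unit using (⊤)
open import Relation.Nullary using (¬_)
open import Relation.Binary.PropositionalEquality using (_≡_; _≢_)
open import Function.Bundles using (_⇔_)

record Graph : Set₁ where
  field
    n     : ℕ
    Adj   : Fin n → Fin n → Set
    sym   : ∀ {u v} → Adj u v → Adj v u
    irrefl : ∀ {v} → ¬ Adj v v

module _ (G : Graph) where
  open Graph G

  -- no isolated vertices, and for each v the subgraph induced on N(v)
  -- is 1-regular: every neighbour w of v has exactly one neighbour inside N(v).
  record LocallyLinear : Set where
    field
      noIsolated : ∀ v → ∃ λ w → Adj v w
      oneRegular : ∀ v w → Adj v w →
        ∃ λ u → (Adj v u × Adj w u) × (∀ u' → Adj v u' → Adj w u' → u' ≡ u)

  -- A triangle, represented canonically by its vertices a < b < c.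
  record Triangle : Set where
    constructor tri
    field
      a b c : Fin n
      a<b : a < b
      b<c : b < c
      ab  : Adj a b
      bc  : Adj b c
      ac  : Adj a c

  open Triangle

  -- equality of triangles as vertex sets (independent of adjacency proofs)
  _≈T_ : Triangle → Triangle → Set
  t ≈T t' = (a t ≡ a t') × (b t ≡ b t') × (c t ≡ c t')

  _∈T_ : Fin n → Triangle → Set
  v ∈T t = (v ≡ a t) ⊎ (v ≡ b t) ⊎ (v ≡ c t)

  AdjStar : Triangle → Triangle → Set
  AdjStar t t' = ¬ (t ≈T t') × (∃ λ v → v ∈T t × v ∈T t')

-- K4 - e on vertex set Fin 4, with the deleted edge {0,1}.
K4-e : Fin 4 → Fin 4 → Set
K4-e zero zero = ⊥
K4-e zero (suc zero) = ⊥
K4-e zero (suc (suc _)) = ⊤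
K4-e (suc zero) zero = ⊥
K4-e (suc zero) (suc zero) = ⊥
K4-e (suc zero) (suc (suc _)) = ⊤
K4-e (suc (suc i)) zero = ⊤
K4-e (suc (suc i)) (suc zero) = ⊤
K4-e (suc (suc zero)) (suc (suc zero)) = ⊥
K4-e (suc (suc zero)) (suc (suc (suc zero))) = ⊤
K4-e (suc (suc (suc zero))) (suc (suc zero)) = ⊤
K4-e (suc (suc (suc zero))) (suc (suc (suc zero))) = ⊥

InducedK4-e : (G : Graph) → Set
InducedK4-e G = Σ (Fin 4 → Triangle G) λ f →
  (∀ i j → i ≢ j → ¬ (_≈T_ G (f i) (f j))) ×
  (∀ i j → AdjStar G (f i) (f j) ⇔ K4-e i j)

{-# OPTIONS --safe #-}
module Submission where

-- Two triangles of a locally linear graph sharing two vertices u, v coincide: the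
-- third vertex of each is the unique common neighbour of the edge uv. Hence if
-- triangles s, t meet each other and each meets a third triangle r different
-- from both, they meet r in the same vertex: otherwise a common vertex of s and t
-- would be a common neighbour of two vertices of r, hence lie in r, and s or t
-- would share two vertices with r. In an induced K4 − e of G* with disjoint ends
-- f₀, f₁, the middle triangles f₂, f₃ thus meet f₀ in one common vertex and f₁ in
-- another, so they share two vertices and coincide.

open import Data.Empty using (⊥-elim)
open import Data.Fin using (Fin; _≤_; _≟_; #_)
open import Data.Fin.Properties using (≤-refl; ≤-antisym; <-trans; <⇒≢)
open import Data.Nat.Properties using (<⇒≤)
open import Data.Product using (∃; _×_; _,_; proj₂)
open import Data.Sum using (inj₁; inj₂)
open import Function using (_∘_)
open import Function.Bundles using (Equivalence)
open import Relation.Nullary using (¬_; yes; no)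
open import Relation.Binary.PropositionalEquality using (_≡_; _≢_; refl; sym; trans; subst)

open import Defs

module Triangles (G : Graph) where
  open Graph G using (n; Adj) renaming (sym to Adj-sym)
  open Triangle

  _∈_ : Fin n → Triangle G → Set
  v ∈ t = _∈T_ G v t

  _≈_ : Triangle G → Triangle G → Set
  s ≈ t = _≈T_ G s t

  _⊆_ : Triangle G → Triangle G → Set
  s ⊆ t = ∀ {v} → v ∈ s → v ∈ t

  Meet : Triangle G → Triangle G → Set
  Meet s t = ∃ λ v → v ∈ s × v ∈ t

  pattern is-a = inj₁ refl
  pattern is-b = inj₂ (inj₁ refl)
  pattern is-c = inj₂ (inj₂ refl)

  a-least : ∀ {v} (t : Triangle G) → v ∈ t → a t ≤ v
  a-least t is-a = ≤-refl
  a-least t is-b = <⇒≤ (a<b t)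
  a-least t is-c = <⇒≤ (<-trans (a<b t) (b<c t))

  c-greatest : ∀ {v} (t : Triangle G) → v ∈ t → v ≤ c t
  c-greatest t is-a = <⇒≤ (<-trans (a<b t) (b<c t))
  c-greatest t is-b = <⇒≤ (b<c t)
  c-greatest t is-c = ≤-refl

  ⊆-antisym : ∀ s t → s ⊆ t → t ⊆ s → s ≈ t
  ⊆-antisym s t s⊆t t⊆s = a≡ , b≡ , c≡
    where
    a≡ : a s ≡ a t
    a≡ = ≤-antisym (a-least s (t⊆s is-a)) (a-least t (s⊆t is-a))

    c≡ : c s ≡ c t
    c≡ = ≤-antisym (c-greatest t (s⊆t is-c)) (c-greatest s (t⊆s is-c))

    b≡ : b s ≡ b t
    b≡ with s⊆t is-b
    ... | inj₁ bs≡at        = ⊥-elim (<⇒≢ (a<b s) (trans a≡ (sym bs≡at)))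
    ... | inj₂ (inj₁ bs≡bt) = bs≡bt
    ... | inj₂ (inj₂ bs≡ct) = ⊥-elim (<⇒≢ (b<c s) (trans bs≡ct (sym c≡)))

  ∈⇒Adj : ∀ {u v} (t : Triangle G) → u ∈ t → v ∈ t → u ≢ v → Adj u v
  ∈⇒Adj t is-a is-a u≢v = ⊥-elim (u≢v refl)
  ∈⇒Adj t is-a is-b _   = ab t
  ∈⇒Adj t is-a is-c _   = ac t
  ∈⇒Adj t is-b is-a _   = Adj-sym (ab t)
  ∈⇒Adj t is-b is-b u≢v = ⊥-elim (u≢v refl)
  ∈⇒Adj t is-b is-c _   = bc t
  ∈⇒Adj t is-c is-a _   = Adj-sym (ac t)
  ∈⇒Adj t is-c is-b _   = Adj-sym (bc t)
  ∈⇒Adj t is-c is-c u≢v = ⊥-elim (u≢v refl)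

  third-vertex : ∀ {u v} (t : Triangle G) → u ∈ t → v ∈ t → u ≢ v →
                 ∃ λ w → w ∈ t × Adj u w × Adj v w
  third-vertex t is-a is-a u≢v = ⊥-elim (u≢v refl)
  third-vertex t is-a is-b _   = c t , is-c , ac t , bc t
  third-vertex t is-a is-c _   = b t , is-b , ab t , Adj-sym (bc t)
  third-vertex t is-b is-a _   = c t , is-c , bc t , ac t
  third-vertex t is-b is-b u≢v = ⊥-elim (u≢v refl)
  third-vertex t is-b is-c _   = a t , is-a , Adj-sym (ab t) , Adj-sym (ac t)
  third-vertex t is-c is-a _   = b t , is-b , Adj-sym (bc t) , ab t
  third-vertex t is-c is-b _   = a t , is-a , Adj-sym (ac t) , Adj-sym (ab t)
  third-vertex t is-c is-c u≢v = ⊥-elim (u≢v refl)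

module LocallyLinearTriangles (G : Graph) (LL : LocallyLinear G) where
  open Graph G using (Adj)
  open LocallyLinear LL
  open Triangles G public

  common-neighbour-unique : ∀ {u v w w′} → Adj u v →
    Adj u w → Adj v w → Adj u w′ → Adj v w′ → w ≡ w′
  common-neighbour-unique uv uw vw uw′ vw′ with oneRegular _ _ uv
  ... | _ , _ , unique = trans (unique _ uw vw) (sym (unique _ uw′ vw′))

  common-neighbour-∈ : ∀ {u v w} (t : Triangle G) → u ∈ t → v ∈ t → u ≢ v →
    Adj u w → Adj v w → w ∈ t
  common-neighbour-∈ t u∈t v∈t u≢v uw vw with third-vertex t u∈t v∈t u≢v
  ... | y , y∈t , uy , vy =
    subst (_∈ t) (common-neighbour-unique (∈⇒Adj t u∈t v∈t u≢v) uy vy uw vw) y∈t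

  share-two⇒⊆ : ∀ {u v} (s t : Triangle G) →
    u ∈ s → v ∈ s → u ∈ t → v ∈ t → u ≢ v → s ⊆ t
  share-two⇒⊆ {u} {v} s t u∈s v∈s u∈t v∈t u≢v {y} y∈s with y ≟ u | y ≟ v
  ... | yes refl | _        = u∈t
  ... | no _     | yes refl = v∈t
  ... | no y≢u   | no y≢v   = common-neighbour-∈ t u∈t v∈t u≢v
    (∈⇒Adj s u∈s y∈s (y≢u ∘ sym)) (∈⇒Adj s v∈s y∈s (y≢v ∘ sym))

  share-two⇒≈ : ∀ {u v} (s t : Triangle G) →
    u ∈ s → v ∈ s → u ∈ t → v ∈ t → u ≢ v → s ≈ t
  share-two⇒≈ s t u∈s v∈s u∈t v∈t u≢v =
    ⊆-antisym s t (share-two⇒⊆ s t u∈s v∈s u∈t v∈t u≢v)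
                  (share-two⇒⊆ t s u∈t v∈t u∈s v∈s u≢v)

  meeting-points-coincide : ∀ {p q x} (r s t : Triangle G) → ¬ s ≈ r → ¬ t ≈ r →
    p ∈ s → p ∈ r → q ∈ t → q ∈ r → x ∈ s → x ∈ t → p ≡ q
  meeting-points-coincide {p} {q} {x} r s t s≉r t≉r p∈s p∈r q∈t q∈r x∈s x∈t
    with p ≟ q
  ... | yes p≡q = p≡q
  ... | no p≢q with x ≟ p | x ≟ q
  ...   | yes refl | _        = ⊥-elim (t≉r (share-two⇒≈ t r x∈t q∈t p∈r q∈r p≢q))
  ...   | no _     | yes refl = ⊥-elim (s≉r (share-two⇒≈ s r p∈s x∈s p∈r q∈r p≢q))
  ...   | no x≢p   | no x≢q   =
    ⊥-elim (s≉r (share-two⇒≈ s r p∈s x∈s p∈r x∈r (x≢p ∘ sym)))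
    where
    x∈r : x ∈ r
    x∈r = common-neighbour-∈ r p∈r q∈r p≢q
      (∈⇒Adj s p∈s x∈s (x≢p ∘ sym)) (∈⇒Adj t q∈t x∈t (x≢q ∘ sym))

  meeting-disjoint-pair⇒≈ : ∀ r₀ r₁ s t → ¬ Meet r₀ r₁ →
    ¬ s ≈ r₀ → ¬ t ≈ r₀ → ¬ s ≈ r₁ → ¬ t ≈ r₁ →
    Meet s r₀ → Meet t r₀ → Meet s r₁ → Meet t r₁ → Meet s t → s ≈ t
  meeting-disjoint-pair⇒≈ r₀ r₁ s t r₀∩r₁≡∅ s≉r₀ t≉r₀ s≉r₁ t≉r₁
    (p , p∈s , p∈r₀) (p′ , p′∈t , p′∈r₀) (q , q∈s , q∈r₁) (q′ , q′∈t , q′∈r₁)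
    (x , x∈s , x∈t) =
    share-two⇒≈ s t p∈s q∈s
      (subst (_∈ t) (sym p≡p′) p′∈t) (subst (_∈ t) (sym q≡q′) q′∈t) p≢q
    where
    p≡p′ : p ≡ p′
    p≡p′ = meeting-points-coincide r₀ s t s≉r₀ t≉r₀ p∈s p∈r₀ p′∈t p′∈r₀ x∈s x∈t

    q≡q′ : q ≡ q′
    q≡q′ = meeting-points-coincide r₁ s t s≉r₁ t≉r₁ q∈s q∈r₁ q′∈t q′∈r₁ x∈s x∈t

    p≢q : p ≢ q
    p≢q refl = r₀∩r₁≡∅ (p , p∈r₀ , q∈r₁)

proposition1 : (G : Graph) → LocallyLinear G → ¬ InducedK4-e G
proposition1 G LL (f , injective , adjacent⇔) =
  injective (# 2) (# 3) (λ ())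
    (meeting-disjoint-pair⇒≈ (f (# 0)) (f (# 1)) (f (# 2)) (f (# 3)) f₀∩f₁≡∅
      (injective (# 2) (# 0) (λ ())) (injective (# 3) (# 0) (λ ()))
      (injective (# 2) (# 1) (λ ())) (injective (# 3) (# 1) (λ ()))
      (meet (# 2) (# 0)) (meet (# 3) (# 0)) (meet (# 2) (# 1)) (meet (# 3) (# 1))
      (meet (# 2) (# 3)))
  where
  open LocallyLinearTriangles G LL

  meet : ∀ i j → {K4-e i j} → Meet (f i) (f j)
  meet i j {i∼j} = proj₂ (Equivalence.from (adjacent⇔ i j) i∼j)

  f₀∩f₁≡∅ : ¬ Meet (f (# 0)) (f (# 1))
  f₀∩f₁≡∅ m = Equivalence.to (adjacent⇔ (# 0) (# 1)) (injective (# 0) (# 1) (λ ()) , m)
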